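{- Assume the multicolor Erdős–Hajnal conjecture: for all integers $k,m\ge 2$ and every coloring $\chi$ of $E(K_k)$ with $m$ colors, there exists $\varepsilon>0$ such that every coloring of the edges of $K_n$ with these $m$ colors contains either $k$ vertices whose edges are colored according to $\chi$ (i.e. a copy of $\chi$) or a set of $n^\varepsilon$ vertices whose edges use at most $m-1$ colors. Then for every grid subgraph $H$ such that no two horizontal edges of $H$ join the same two columns, $H\in\mathbf{PGR}$, i.e. there is a constant $C_H$ with $\operatorname{gr}(H,K_k)\le k^{C_H}$ for all $k\ge 2$.
   Context: A grid subgraph on $c$ columns and $r$ rows is a graph whose vertex set is a subset of $[c]\times[r]$ (vertex $(x,y)$ lies in column $x$, row $y$) and whose edges each join two vertices in the same row (horizontal edge) or the same column (vertical edge). A horizontal edge $\{(x,y),(x',y)\}$ is said to be between columns $x$ and $x'$. $G_{N\times N}=K_N\square K_N$; a spanning grid subgraph is a spanning subgraph of it. An embedding of $H$ (on $c_H$ columns, $r_H$ rows) into $G$ is a pair of injections $\varphi_c:[c_H]\to[c_G]$, $\varphi_r:[r_H]\to[r_G]$ sending each edge $\{(x,y),(x',y')\}$ of $H$ to an edge $\{(\varphi_c(x),\varphi_r(y)),(\varphi_c(x'),\varphi_r(y'))\}$ of $G$; $G$ contains $H$ if one exists. A coclique of size $k$ is a set of $k$ pairwise non-adjacent vertices all in one row or all in one column. $\operatorname{gr}(H,K_k)$ is the least $N$ such that every spanning grid subgraph of $G_{N\times N}$ contains $H$ or a coclique of size $k$. $\mathbf{PGR}$ is the class of grid subgraphs $H$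 with $\operatorname{gr}(H,K_k)=k^{O_H(1)}$. -}

module Defs where

open import Data.Nat using (ℕ; suc; _≤_; _^_)
open import Data.Fin using (Fin)
open import Data.Bool using (Bool; true; false)
open import Data.Product using (Σ; ∃; _×_; _,_)
open import Data.Sum using (_⊎_)
open import Relation.Binary.PropositionalEquality using (_≡_; _≢_)
open import Function.Definitions using (Injective)

-- Grid graphs on c columns and r rows.
-- Vertex (x , y) : column x, row y.  V x y = true iff (x,y) is a vertex;
-- E x y x' y' = true iff {(x,y),(x',y')} is an edge.

record Grid (c r : ℕ) : Set where
  field
    V : Fin c → Fin r → Bool
    E : Fin c → Fin r → Fin c → Fin r → Bool

open Grid public

IsGridSubgraph : ∀ {c r} → Grid c r → Set
IsGridSubgraph {c} {r} H =
  (∀ x y x' y' → E H x y x' y' ≡ E H x' y' x y) ×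
  (∀ x y x' y' → E H x y x' y' ≡ true →
     (V H x y ≡ true) × (V H x' y' ≡ true) ×
     (((y ≡ y') × (x ≢ x')) ⊎ ((x ≡ x') × (y ≢ y'))))

IsSpanningGridSubgraph : ∀ {N} → Grid N N → Set
IsSpanningGridSubgraph G = IsGridSubgraph G × (∀ x y → V G x y ≡ true)

NoTwoHorizontalSameColumns : ∀ {c r} → Grid c r → Set
NoTwoHorizontalSameColumns {c} {r} H =
  ∀ (x x' : Fin c) (y y' : Fin r) →
    E H x y x' y ≡ true → E H x y' x' y' ≡ true → y ≡ y'

Embedding : ∀ {cH rH cG rG} → Grid cH rH → Grid cG rG → Set
Embedding {cH} {rH} {cG} {rG} H G =
  Σ (Fin cH → Fin cG) λ φc → Σ (Fin rH → Fin rG) λ φr →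
    Injective _≡_ _≡_ φc × Injective _≡_ _≡_ φr ×
    (∀ x y x' y' → E H x y x' y' ≡ true →
       E G (φc x) (φr y) (φc x') (φr y') ≡ true)

Contains : ∀ {cG rG cH rH} → Grid cG rG → Grid cH rH → Set
Contains G H = Embedding H G

-- A coclique of size k: k pairwise non-adjacent vertices in one row or
-- in one column (G spanning, so all positions are vertices).
HasCoclique : ∀ {N} → Grid N N → ℕ → Set
HasCoclique {N} G k =
  (Σ (Fin N) λ y → Σ (Fin k → Fin N) λ f → Injective _≡_ _≡_ f ×
     (∀ i j → i ≢ j → E G (f i) y (f j) y ≡ false))
  ⊎
  (Σ (Fin N) λ x → Σ (Fin k → Fin N) λ f → Injective _≡_ _≡_ f ×
     (∀ i j → i ≢ j → E G x (f i) x (f j) ≡ false))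

GRProperty : ∀ {c r} → Grid c r → ℕ → ℕ → Set
GRProperty H k N =
  (G : Grid N N) → IsSpanningGridSubgraph G → Contains G H ⊎ HasCoclique G k

-- gr(H,K_k) ≤ M, gr being the least N with GRProperty.
GrAtMost : ∀ {c r} → Grid c r → ℕ → ℕ → Set
GrAtMost H k M = Σ ℕ λ N → (N ≤ M) × GRProperty H k N

InPGR : ∀ {c r} → Grid c r → Set
InPGR H = Σ ℕ λ C → ∀ k → 2 ≤ k → GrAtMost H k (k ^ C)

-- A colouring of E(K_n): symmetric function on pairs (diagonal ignored).
Coloring : ℕ → ℕ → Set
Coloring n m = Σ (Fin n → Fin n → Fin m) λ col → ∀ i j → col i j ≡ col j i

col : ∀ {n m} → Coloring n m → Fin n → Fin n → Fin m
col (c , _) = c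

ContainsCopy : ∀ {n k m} → Coloring n m → Coloring k m → Set
ContainsCopy {n} {k} κ χ =
  Σ (Fin k → Fin n) λ f → Injective _≡_ _≡_ f ×
    (∀ i j → i ≢ j → col κ (f i) (f j) ≡ col χ i j)

-- a set of at least n^(1/q) vertices (s^q ≥ n) whose edges use at most
-- m-1 colours (i.e. some colour a is not used).
HasFewColourSet : ∀ {n m} → Coloring n m → ℕ → Set
HasFewColourSet {n} {m} κ q =
  Σ ℕ λ s → (n ≤ s ^ q) × Σ (Fin s → Fin n) λ g → Injective _≡_ _≡_ g ×
    Σ (Fin m) λ a → ∀ i j → i ≢ j → col κ (g i) (g j) ≢ a

-- Multicolour Erdős–Hajnal conjecture, with ε = 1/(q+1).
MultiColorEH : Set
MultiColorEH =
  ∀ k m → 2 ≤ k → 2 ≤ m → (χ : Coloring k m) →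
    Σ ℕ λ q → ∀ n (κ : Coloring n m) →
      ContainsCopy κ χ ⊎ HasFewColourSet κ (suc q)

{-# OPTIONS --safe #-}
-- In each column of the host graph, colour the pairs among the first M = poly(k) rows by adjacency:
-- multicolour Erdős–Hajnal gives in every column a k-coclique or an r-clique. Pigeonholing the columns
-- over the M^r possible cliques leaves many columns that are cliques on one common set of r rows. Colour
-- pairs of these columns by their adjacency vectors in those rows (2^r colours). Since no two horizontal
-- edges of H join the same two columns, H asks each pair of its columns for an edge in at most one row:
-- its horizontal edges form a pattern over the colour classes "adjacent in row t". Erdős–Hajnal, applied
-- to a colouring realising this pattern, finds it or a large set missing some colour, on which we drop
-- that colour and repeat. Each of the at most 2^r rounds costs a fixed root of the size, so every
-- threshold is a fixed power of k.
module Submission where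

open import Defs
open import Data.Bool using (Bool; true; false)
open import Data.Bool.Properties using (¬-not) renaming (_≟_ to _≟ᵇ_)
open import Data.Empty using (⊥-elim)
open import Data.Fin using (Fin; zero; suc; inject≤; lift; punchIn; punchOut; combine; funToFin; finToFun)
open import Data.Fin.Properties
  using (¬Fin0; _≟_; any?; all?; ¬∀⟶∃¬; inject≤-injective; lift-injective; suc-injective;
         punchIn-punchOut; finToFun-funToFin; 2↔Bool; sequence)
open import Data.Nat
  using (ℕ; zero; suc; _+_; _*_; _^_; _⊔_; _≤_; _<_; z≤n; s≤s; z<s; _≤?_; NonZero; >-nonZero)
open import Data.Nat.Properties
  using (≤-refl; ≤-reflexive; ≤-trans; <-trans; ≤-<-trans; <⇒≤; <⇒≱; ≮⇒≥; ≰⇒>; n<1+n;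
         m≤m+n; m≤n+m; m≤m*n; m≤n*m; m≤m⊔n; m≤n⊔m; +-suc; +-monoˡ-≤; +-cancelˡ-≤;
         *-identityˡ; *-assoc; m*n≢0; ^-*-assoc; ^-distribˡ-+-*; ^-monoʳ-≤; ^-monoˡ-<; ^-monoʳ-<;
         m^n≢0; m^n>0)
open import Data.Product using (Σ; ∃; _×_; _,_; proj₁; proj₂)
open import Data.Sum using (_⊎_; inj₁; inj₂; [_,_]′; map₂)
import Data.Sum.Effectful.Left as SumLeft
open import Function using (_∘_; id; Inverse)
open import Function.Definitions using (Injective)
open import Level using (0ℓ)
open import Relation.Nullary using (¬_; yes; no; contradiction)
open import Relation.Unary using (Decidable)
open import Relation.Binary.PropositionalEquality
  using (_≡_; _≢_; refl; sym; trans; cong; cong₂; subst; subst₂; module ≡-Reasoning)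

^-cancelʳ-≤ : ∀ q {x y} → x ^ suc q ≤ y ^ suc q → x ≤ y
^-cancelʳ-≤ q xᵠ≤yᵠ = ≮⇒≥ (λ y<x → <⇒≱ (^-monoˡ-< (suc q) y<x) xᵠ≤yᵠ)

n<m^n : ∀ {m} n → 1 < m → n < m ^ n
n<m^n zero    _ = z<s
n<m^n {m} (suc n) 1<m = ≤-<-trans (n<m^n n 1<m) (^-monoʳ-< m 1<m (n<1+n n))

m≤m^[1+n] : ∀ m n .{{_ : NonZero m}} → m ≤ m ^ suc n
m≤m^[1+n] m n = m≤m*n m (m ^ n) {{m^n≢0 m n}}

m+n≤o+p⇒o<m⇒n≤p : ∀ {m n o p} → m + n ≤ o + p → o < m → n ≤ p
m+n≤o+p⇒o<m⇒n≤p {n = n} {o} m+n≤o+p o<m =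
  +-cancelˡ-≤ o _ _ (≤-trans (+-monoˡ-≤ n (<⇒≤ o<m)) m+n≤o+p)

upperBound : ∀ {I} (f : Fin I → ℕ) → ∃ λ b → ∀ i → f i ≤ b
upperBound {zero}  f = 0 , λ ()
upperBound {suc I} f =
  let (b , f∘suc≤b) = upperBound (f ∘ suc)
  in f zero ⊔ b , λ { zero    → m≤m⊔n (f zero) b
                    ; (suc i) → ≤-trans (f∘suc≤b i) (m≤n⊔m (f zero) b) }

Fin1-unique : (i j : Fin 1) → i ≡ j
Fin1-unique zero zero = refl

initialSegment : ∀ {k n} → k ≤ n → Σ (Fin k → Fin n) (Injective _≡_ _≡_)
initialSegment k≤n = (λ i → inject≤ i k≤n) , λ {i} {j} → inject≤-injective k≤n k≤n i j

Witnesses : ∀ {N} → (Fin N → Set) → ℕ → Set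
Witnesses {N} P n = Σ (Fin n → Fin N) λ e → Injective _≡_ _≡_ e × (∀ i → P (e i))

noWitnesses : ∀ {N} {P : Fin N → Set} → Witnesses P 0
noWitnesses = (λ ()) , (λ { {()} }) , (λ ())

consWitness : ∀ {N n} {P : Fin (suc N) → Set} → P zero → Witnesses (P ∘ suc) n → Witnesses P (suc n)
consWitness p (e , e-inj , e-P) = lift 1 e , lift-injective e e-inj 1 , λ { zero → p ; (suc i) → e-P i }

sucWitnesses : ∀ {N n} {P : Fin (suc N) → Set} → Witnesses (P ∘ suc) n → Witnesses P n
sucWitnesses (e , e-inj , e-P) = suc ∘ e , e-inj ∘ suc-injective , e-P

takeWitnesses : ∀ {N n s} {P : Fin N → Set} → s ≤ n → Witnesses P n → Witnesses P s
takeWitnesses s≤n (e , e-inj , e-P) =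
  let (ι , ι-inj) = initialSegment s≤n in e ∘ ι , ι-inj ∘ e-inj , e-P ∘ ι

partition : ∀ {N} (P : Fin N → Set) → Decidable P →
            Σ ℕ λ n₁ → Σ ℕ λ n₂ → n₁ + n₂ ≡ N × Witnesses P n₁ × Witnesses (λ x → ¬ P x) n₂
partition {zero}  P P? = 0 , 0 , refl , noWitnesses {P = P} , noWitnesses {P = λ x → ¬ P x}
partition {suc N} P P? with partition (λ x → P (suc x)) (λ x → P? (suc x)) | P? zero
... | n₁ , n₂ , n₁+n₂≡N , ins , outs | yes p =
  suc n₁ , n₂ , cong suc n₁+n₂≡N , consWitness {P = P} p ins , sucWitnesses {P = λ x → ¬ P x} outs
... | n₁ , n₂ , n₁+n₂≡N , ins , outs | no ¬p =
  n₁ , suc n₂ , trans (+-suc n₁ n₂) (cong suc n₁+n₂≡N) ,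
  sucWitnesses {P = P} ins , consWitness {P = λ x → ¬ P x} ¬p outs

-- The colour a itself, which colourings below take only on the diagonal, goes to an arbitrary colour.
removeColour : ∀ {m} → Fin (suc (suc m)) → Fin (suc (suc m)) → Fin (suc m)
removeColour a b with a ≟ b
... | yes _   = zero
... | no a≢b = punchOut a≢b

punchIn-removeColour : ∀ {m} {a b : Fin (suc (suc m))} → a ≢ b → punchIn a (removeColour a b) ≡ b
punchIn-removeColour {a = a} {b} a≢b with a ≟ b
... | yes a≡b  = contradiction a≡b a≢b
... | no a≢b′ = punchIn-punchOut a≢b′

pigeonhole-fibre : ∀ {N} K .{{_ : NonZero K}} {s} (f : Fin N → Fin K) → K * s ≤ N →
                   Σ (Fin K) λ v → Witnesses (λ x → f x ≡ v) s
pigeonhole-fibre (suc K) = fibre K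
  where
  fibre : ∀ {N} K {s} (f : Fin N → Fin (suc K)) → suc K * s ≤ N →
          Σ (Fin (suc K)) λ v → Witnesses (λ x → f x ≡ v) s
  fibre zero f 1*s≤N =
    let (e , e-inj) = initialSegment (subst (_≤ _) (*-identityˡ _) 1*s≤N)
    in zero , e , e-inj , λ _ → Fin1-unique _ _
  fibre (suc K) {s} f h with partition (λ x → f x ≡ zero) (λ x → f x ≟ zero)
  ... | n₁ , n₂ , n₁+n₂≡N , zeros , (e , e-inj , e-P) with s ≤? n₁
  ...   | yes s≤n₁ = zero , takeWitnesses {P = λ x → f x ≡ zero} s≤n₁ zeros
  ...   | no s≰n₁
    with fibre K (removeColour zero ∘ f ∘ e)
                 (m+n≤o+p⇒o<m⇒n≤p (subst (_ ≤_) (sym n₁+n₂≡N) h) (≰⇒> s≰n₁))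
  ...     | v , g , g-inj , g-P =
    suc v , e ∘ g , g-inj ∘ e-inj ,
    λ i → trans (sym (punchIn-removeColour (e-P (g i) ∘ sym))) (cong suc (g-P i))

funToFin-cong : ∀ {m n} {f g : Fin m → Fin n} → (∀ i → f i ≡ g i) → funToFin f ≡ funToFin g
funToFin-cong {zero}  _   = refl
funToFin-cong {suc m} f≗g = cong₂ combine (f≗g zero) (funToFin-cong (f≗g ∘ suc))

-- One Erdős–Hajnal exponent for finitely many patterns

multiColorEH-anySize : MultiColorEH → ∀ {c m} → 2 ≤ m → (χ : Coloring c m) →
  ∃ λ q → ∀ n (κ : Coloring n m) → ContainsCopy κ χ ⊎ HasFewColourSet κ (suc q)
multiColorEH-anySize eh {zero} _ χ = 0 , λ _ _ → inj₁ ((λ ()) , (λ { {()} }) , λ ())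
multiColorEH-anySize eh {suc zero} (s≤s (s≤s _)) χ = 0 , singleVertex
  where
  singleVertex : ∀ n (κ : Coloring n _) → ContainsCopy κ χ ⊎ HasFewColourSet κ 1
  singleVertex zero    _ = inj₂ (0 , z≤n , (λ ()) , (λ { {()} }) , zero , λ ())
  singleVertex (suc n) _ =
    inj₁ ((λ _ → zero) , (λ {i} {j} _ → Fin1-unique i j) ,
          λ i j i≢j → contradiction (Fin1-unique i j) i≢j)
multiColorEH-anySize eh {suc (suc c)} 2≤m χ = eh _ _ (s≤s (s≤s z≤n)) 2≤m χ

HasFewColourSet-mono : ∀ {n m q Q} {κ : Coloring n m} → q ≤ Q →
                       HasFewColourSet κ (suc q) → HasFewColourSet κ (suc Q)
HasFewColourSet-mono q≤Q (zero  , n≤0 , few) = zero , n≤0 , few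
HasFewColourSet-mono q≤Q (suc s , n≤sᵠ , few) =
  suc s , ≤-trans n≤sᵠ (^-monoʳ-≤ (suc s) (s≤s q≤Q)) , few

uniformEH : MultiColorEH → ∀ {c m I} → 2 ≤ m → (χ : Fin I → Coloring c m) →
  ∃ λ Q → ∀ i n (κ : Coloring n m) → ContainsCopy κ (χ i) ⊎ HasFewColourSet κ (suc Q)
uniformEH eh 2≤m χ =
  let (Q , q≤Q) = upperBound (λ i → proj₁ (exponent i))
  in Q , λ i n κ → map₂ (HasFewColourSet-mono {κ = κ} (q≤Q i)) (proj₂ (exponent i) n κ)
  where
  exponent : ∀ i → ∃ λ q → ∀ n (κ : Coloring n _) → ContainsCopy κ (χ i) ⊎ HasFewColourSet κ (suc q)
  exponent i = multiColorEH-anySize eh 2≤m (χ i)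

classGraphs : ∀ {n m R} → (Fin m → Fin R → Bool) → Coloring n m → Fin R → Fin n → Fin n → Bool
classGraphs inClass κ t x y = inClass (col κ x y) t

emptyClass-or-allInhabited : ∀ {m R} (inClass : Fin m → Fin R → Bool) →
  (∃ λ t → ∀ a → inClass a t ≡ false) ⊎ (∀ t → ∃ λ a → inClass a t ≡ true)
emptyClass-or-allInhabited inClass with any? (λ t → all? (λ a → inClass a t ≟ᵇ false))
... | yes empty  = inj₁ empty
... | no ∄empty = inj₂ λ t →
  let (a , a∈t) = ¬∀⟶∃¬ _ _ (λ a → inClass a t ≟ᵇ false) (∄empty ∘ (t ,_)) in a , ¬-not a∈t

layers : ∀ {R n} (graph : Fin R → Fin n → Fin n → Bool) → (∀ t x y → graph t x y ≡ graph t y x) →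
         Coloring n (2 ^ R)
layers graph graph-sym =
  (λ x y → funToFin (λ t → from (graph t x y))) ,
  (λ x y → funToFin-cong (λ t → cong from (graph-sym t x y)))
  where open Inverse 2↔Bool

layer : ∀ {R} → Fin (2 ^ R) → Fin R → Bool
layer a t = Inverse.to 2↔Bool (finToFun a t)

classGraphs-layers : ∀ {R n} (graph : Fin R → Fin n → Fin n → Bool) graph-sym t x y →
                     classGraphs layer (layers graph graph-sym) t x y ≡ graph t x y
classGraphs-layers graph graph-sym t x y =
  trans (cong to (finToFun-funToFin _ t)) (strictlyInverseˡ (graph t x y))
  where open Inverse 2↔Bool

module _ {c R : ℕ} (req : Fin c → Fin c → Fin R → Bool) where

  -- req i j t: the pattern asks for {i, j} to be an edge of graph t.
  PatternOrIndependent : ∀ {n} → (Fin R → Fin n → Fin n → Bool) → ℕ → Set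
  PatternOrIndependent {n} graph k =
    (Σ (Fin c → Fin n) λ σ → Injective _≡_ _≡_ σ ×
       (∀ i j t → i ≢ j → req i j t ≡ true → graph t (σ i) (σ j) ≡ true)) ⊎
    (Σ (Fin R) λ t → Σ (Fin k → Fin n) λ g → Injective _≡_ _≡_ g ×
       (∀ i j → i ≢ j → graph t (g i) (g j) ≡ false))

  PatternOrIndependent-restrict :
    ∀ {n n′ k} {graph : Fin R → Fin n → Fin n → Bool} {graph′ : Fin R → Fin n′ → Fin n′ → Bool}
    (g : Fin n′ → Fin n) → Injective _≡_ _≡_ g →
    (∀ t i j → i ≢ j → graph′ t i j ≡ graph t (g i) (g j)) →
    PatternOrIndependent graph′ k → PatternOrIndependent graph k
  PatternOrIndependent-restrict g g-inj agree (inj₁ (σ , σ-inj , realised)) =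
    inj₁ (g ∘ σ , σ-inj ∘ g-inj ,
          λ i j t i≢j r → trans (sym (agree t _ _ (i≢j ∘ σ-inj))) (realised i j t i≢j r))
  PatternOrIndependent-restrict g g-inj agree (inj₂ (t , h , h-inj , independent)) =
    inj₂ (t , g ∘ h , h-inj ∘ g-inj ,
          λ i j i≢j → trans (sym (agree t _ _ (i≢j ∘ h-inj))) (independent i j i≢j))

  emptyClass⇒independent : ∀ {m k n t} (inClass : Fin m → Fin R → Bool) (κ : Coloring n m) →
    (∀ a → inClass a t ≡ false) → k ≤ n → PatternOrIndependent (classGraphs inClass κ) k
  emptyClass⇒independent {t = t} _ _ empty k≤n =
    let (g , g-inj) = initialSegment k≤n in inj₂ (t , g , g-inj , λ _ _ _ → empty _)

  singleColour : ∀ {k n} (inClass : Fin 1 → Fin R → Bool) (κ : Coloring n 1) →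
    k ≤ n → c ≤ n → PatternOrIndependent (classGraphs inClass κ) k
  singleColour inClass κ k≤n c≤n with emptyClass-or-allInhabited inClass
  ... | inj₁ (_ , empty) = emptyClass⇒independent inClass κ empty k≤n
  ... | inj₂ inhabited =
    let (σ , σ-inj) = initialSegment c≤n
    in inj₁ (σ , σ-inj , λ _ _ t _ _ →
         subst (λ a → inClass a t ≡ true) (Fin1-unique _ _) (proj₂ (inhabited t)))

module MultiColourPattern (eh : MultiColorEH) {c R : ℕ} (req : Fin c → Fin c → Fin R → Bool)
  (req-sym : ∀ i j t → req i j t ≡ req j i t)
  (req-unique : ∀ {i j t t′} → req i j t ≡ true → req i j t′ ≡ true → t ≡ t′) where

  patternColour : ∀ {m} → (Fin R → Fin (suc m)) → Fin c → Fin c → Fin (suc m)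
  patternColour A i j with any? (λ t → req i j t ≟ᵇ true)
  ... | yes (t , _) = A t
  ... | no _        = zero

  patternColour-req : ∀ {m} (A : Fin R → Fin (suc m)) {i j t} →
                      req i j t ≡ true → patternColour A i j ≡ A t
  patternColour-req A {i} {j} {t} r with any? (λ t → req i j t ≟ᵇ true)
  ... | yes (t′ , r′) = cong A (req-unique r′ r)
  ... | no ∄t         = contradiction (t , r) ∄t

  patternColour-sym : ∀ {m} (A : Fin R → Fin (suc m)) i j → patternColour A i j ≡ patternColour A j i
  patternColour-sym A i j with any? (λ t → req i j t ≟ᵇ true)
  ... | yes (t , r) = sym (patternColour-req A (trans (req-sym j i t) r))
  ... | no ∄t with any? (λ t → req j i t ≟ᵇ true)
  ...   | yes (t , r) = contradiction (t , trans (req-sym i j t) r) ∄t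
  ...   | no _        = refl

  patternColouring : ∀ {m} → (Fin R → Fin (suc m)) → Coloring c (suc m)
  patternColouring A = patternColour A , patternColour-sym A

  -- Thresholds are written L ^ suc e so that they are at least L, hence at least k and c.
  Threshold : ℕ → ℕ → Set
  Threshold m e = ∀ {k L n} .{{_ : NonZero L}} (inClass : Fin m → Fin R → Bool) (κ : Coloring n m) →
                  k ≤ L → c ≤ L → L ^ suc e ≤ n → PatternOrIndependent req (classGraphs inClass κ) k

  noColours : Threshold 0 0
  noColours {L = L} _ κ _ _ L¹≤n = ⊥-elim (¬Fin0 (col κ x x))
    where x = inject≤ zero (≤-trans (m^n>0 L 1) L¹≤n)

  oneColour : Threshold 1 0
  oneColour {L = L} inClass κ k≤L c≤L L¹≤n =
    singleColour req inClass κ (≤-trans k≤L L≤n) (≤-trans c≤L L≤n)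
    where L≤n = ≤-trans (m≤m^[1+n] L 0) L¹≤n

  -- Colour choices Fin R → Fin (2 + m) are indexed by Fin ((2 + m) ^ R), so one EH exponent Q serves all.
  fewerColours : ∀ {m e Q} → Threshold (suc m) e →
    (∀ a n (κ : Coloring n (suc (suc m))) →
       ContainsCopy κ (patternColouring (finToFun a)) ⊎ HasFewColourSet κ (suc Q)) →
    Threshold (suc (suc m)) (Q + e * suc Q)
  fewerColours {m} {e} {Q} threshold uniformQ {k} {L} {n} inClass κ k≤L c≤L Lᵉ≤n
    with emptyClass-or-allInhabited inClass
  ... | inj₁ (_ , empty) =
    emptyClass⇒independent req inClass κ empty
      (≤-trans k≤L (≤-trans (m≤m^[1+n] L (Q + e * suc Q)) Lᵉ≤n))
  ... | inj₂ inhabited = [ copy⇒pattern , fewColours⇒smaller ]′ (uniformQ (funToFin choice) n κ)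
    where
    choice : Fin R → Fin (suc (suc m))
    choice t = proj₁ (inhabited t)

    chosen : ∀ t → inClass (finToFun (funToFin choice) t) t ≡ true
    chosen t = subst (λ a → inClass a t ≡ true) (sym (finToFun-funToFin choice t)) (proj₂ (inhabited t))

    copy⇒pattern : ContainsCopy κ (patternColouring (finToFun (funToFin choice))) →
                   PatternOrIndependent req (classGraphs inClass κ) k
    copy⇒pattern (f , f-inj , copy) = inj₁ (f , f-inj , λ i j t i≢j r →
      subst (λ a → inClass a t ≡ true) (sym (trans (copy i j i≢j) (patternColour-req _ r))) (chosen t))

    fewColours⇒smaller : HasFewColourSet κ (suc Q) → PatternOrIndependent req (classGraphs inClass κ) k
    fewColours⇒smaller (s , n≤sᵠ , g , g-inj , a , a-missing) =
      PatternOrIndependent-restrict req {graph = classGraphs inClass κ} g g-inj agree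
        (threshold (inClass ∘ punchIn a) κ′ k≤L c≤L Lᵉ≤s)
      where
      κ′ : Coloring s (suc m)
      κ′ = (λ i j → removeColour a (col κ (g i) (g j))) ,
           (λ i j → cong (removeColour a) (proj₂ κ (g i) (g j)))

      agree : ∀ t i j → i ≢ j →
              classGraphs (inClass ∘ punchIn a) κ′ t i j ≡ classGraphs inClass κ t (g i) (g j)
      agree t i j i≢j = cong (λ b → inClass b t) (punchIn-removeColour (a-missing i j i≢j ∘ sym))

      -- suc (Q + e * suc Q) is suc e * suc Q by definition
      Lᵉ≤s : L ^ suc e ≤ s
      Lᵉ≤s = ^-cancelʳ-≤ Q
        (≤-trans (≤-reflexive (^-*-assoc L (suc e) (suc Q))) (≤-trans Lᵉ≤n n≤sᵠ))

  patternOrIndependent : ∀ m → ∃ (Threshold m)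
  patternOrIndependent zero          = 0 , noColours
  patternOrIndependent (suc zero)    = 0 , oneColour
  patternOrIndependent (suc (suc m)) =
    let (e , threshold) = patternOrIndependent (suc m)
        (Q , uniformQ)  = uniformEH eh (s≤s (s≤s z≤n)) (patternColouring ∘ finToFun)
    in Q + e * suc Q , fewerColours {e = e} {Q} threshold uniformQ

  layeredPatternOrIndependent :
    ∃ λ e → ∀ {k L n} .{{_ : NonZero L}} (graph : Fin R → Fin n → Fin n → Bool) →
      (∀ t x y → graph t x y ≡ graph t y x) →
      k ≤ L → c ≤ L → L ^ suc e ≤ n → PatternOrIndependent req graph k
  layeredPatternOrIndependent =
    let (e , threshold) = patternOrIndependent (2 ^ R)
    in e , λ graph graph-sym k≤L c≤L Lᵉ≤n →
         PatternOrIndependent-restrict req id id (λ t x y _ → classGraphs-layers graph graph-sym t x y)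
           (threshold layer (layers graph graph-sym) k≤L c≤L Lᵉ≤n)

record CliqueFrame {N} (G : Grid N N) (n r : ℕ) : Set where
  field
    column           : Fin n → Fin N
    column-injective : Injective _≡_ _≡_ column
    row              : Fin r → Fin N
    row-injective    : Injective _≡_ _≡_ row
    vertical         : ∀ x {y y′} → y ≢ y′ → E G (column x) (row y) (column x) (row y′) ≡ true

module GridRamsey (eh : MultiColorEH) {c r : ℕ} (H : Grid c r) (gH : IsGridSubgraph H)
  (noTwo : NoTwoHorizontalSameColumns H) where

  complete : Fin r → Fin r → Fin 1 → Bool
  complete _ _ _ = true

  horizontal : Fin c → Fin c → Fin r → Bool
  horizontal x x′ y = E H x y x′ y

  open MultiColourPattern eh complete (λ _ _ _ → refl) (λ {_} {_} {t} {t′} _ _ → Fin1-unique t t′)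
    using () renaming (layeredPatternOrIndependent to cliqueOrIndependent)
  open MultiColourPattern eh horizontal
         (λ x x′ y → proj₁ gH x y x′ y) (λ {x} {x′} {y} {y′} → noTwo x x′ y y′)
    using () renaming (layeredPatternOrIndependent to horizontalOrIndependent)

  eRow eCol : ℕ
  eRow = proj₁ cliqueOrIndependent
  eCol = proj₁ horizontalOrIndependent

  ColumnClique : ∀ {N M} (G : Grid N N) → (Fin M → Fin N) → Fin N → Set
  ColumnClique {M = M} G rows x = Σ (Fin r → Fin M) λ σ → Injective _≡_ _≡_ σ ×
    (∀ i j → i ≢ j → E G x (rows (σ i)) x (rows (σ j)) ≡ true)

  module _ {N : ℕ} {G : Grid N N} where

    columnCoclique-or-clique : ∀ {k L M} .{{_ : NonZero L}} → IsGridSubgraph G →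
      k ≤ L → r ≤ L → L ^ suc eRow ≤ M → (rows : Fin M → Fin N) → Injective _≡_ _≡_ rows →
      ∀ x → HasCoclique G k ⊎ ColumnClique G rows x
    columnCoclique-or-clique gG k≤L r≤L Lᵉ≤M rows rows-inj x
      with proj₂ cliqueOrIndependent (λ _ y y′ → E G x (rows y) x (rows y′))
                                     (λ _ y y′ → proj₁ gG x (rows y) x (rows y′)) k≤L r≤L Lᵉ≤M
    ... | inj₁ (σ , σ-inj , clique) = inj₂ (σ , σ-inj , λ i j i≢j → clique i j zero i≢j refl)
    ... | inj₂ (_ , g , g-inj , independent) =
      inj₁ (inj₂ (x , rows ∘ g , g-inj ∘ rows-inj , independent))

    sharedCliqueFrame : ∀ {M n} {rows : Fin M → Fin N} → Injective _≡_ _≡_ rows →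
      (cliques : ∀ x → ColumnClique G rows x) →
      ∀ v → Witnesses (λ x → funToFin (proj₁ (cliques x)) ≡ v) (suc n) → CliqueFrame G (suc n) r
    sharedCliqueFrame {rows = rows} rows-inj cliques v (columns , columns-inj , shared) = record
      { column           = columns
      ; column-injective = columns-inj
      ; row              = rows ∘ finToFun v
      ; row-injective    = λ eq → proj₁ (proj₂ (cliques (columns zero)))
                             (trans (clique≗v zero _) (trans (rows-inj eq) (sym (clique≗v zero _))))
      ; vertical         = λ x {y} {y′} y≢y′ →
                             subst₂ (λ a b → E G (columns x) (rows a) (columns x) (rows b) ≡ true)
                               (clique≗v x y) (clique≗v x y′)
                               (proj₂ (proj₂ (cliques (columns x))) y y′ y≢y′)
      }
      where
      clique≗v : ∀ i t → proj₁ (cliques (columns i)) t ≡ finToFun v t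
      clique≗v i t = trans (sym (finToFun-funToFin _ t)) (cong (λ a → finToFun a t) (shared i))

    commonCliqueFrame : ∀ {M n} .{{_ : NonZero M}} .{{_ : NonZero n}} {rows : Fin M → Fin N} →
      Injective _≡_ _≡_ rows → (∀ x → ColumnClique G rows x) → M ^ r * n ≤ N → CliqueFrame G n r
    commonCliqueFrame {M} {suc n} rows-inj cliques Mʳn≤N =
      let (v , fibre) =
            pigeonhole-fibre (M ^ r) {{m^n≢0 M r}} (λ x → funToFin (proj₁ (cliques x))) Mʳn≤N
      in sharedCliqueFrame rows-inj cliques v fibre

  module _ {N n : ℕ} {G : Grid N N} (F : CliqueFrame G n r) where
    open CliqueFrame F

    rowGraphs : Fin r → Fin n → Fin n → Bool
    rowGraphs y i j = E G (column i) (row y) (column j) (row y)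

    frameEmbedding : (σ : Fin c → Fin n) → Injective _≡_ _≡_ σ →
      (∀ x x′ y → x ≢ x′ → horizontal x x′ y ≡ true → rowGraphs y (σ x) (σ x′) ≡ true) →
      Contains G H
    frameEmbedding σ σ-inj horizontals =
      column ∘ σ , row , σ-inj ∘ column-injective , row-injective , edges
      where
      edges : ∀ x y x′ y′ → E H x y x′ y′ ≡ true →
              E G (column (σ x)) (row y) (column (σ x′)) (row y′) ≡ true
      edges x y x′ y′ e with proj₂ (proj₂ (proj₂ gH x y x′ y′ e))
      ... | inj₁ (refl , x≢x′) = horizontals x x′ y x≢x′ e
      ... | inj₂ (refl , y≢y′) = vertical (σ x) y≢y′

    frameEmbedding-or-rowCoclique : ∀ {k L} .{{_ : NonZero L}} → IsGridSubgraph G →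
      k ≤ L → c ≤ L → L ^ suc eCol ≤ n → Contains G H ⊎ HasCoclique G k
    frameEmbedding-or-rowCoclique gG k≤L c≤L Lᵉ≤n
      with proj₂ horizontalOrIndependent rowGraphs (λ y i j → proj₁ gG _ _ _ _) k≤L c≤L Lᵉ≤n
    ... | inj₁ (σ , σ-inj , horizontals) = inj₁ (frameEmbedding σ σ-inj horizontals)
    ... | inj₂ (y , g , g-inj , independent) =
      inj₂ (inj₁ (row y , column ∘ g , g-inj ∘ column-injective , independent))

  gridExponent : ℕ
  gridExponent = suc eRow * suc r + suc eCol

  gridRamsey : ∀ {k L} .{{_ : NonZero L}} → k ≤ L → c ≤ L → r ≤ L → GRProperty H k (L ^ gridExponent)
  gridRamsey {k} {L} k≤L c≤L r≤L G (gG , _) =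
    [ inj₂ , (λ cliques → frameEmbedding-or-rowCoclique (commonCliqueFrame rows-inj cliques Mʳn≤N)
                                                          gG k≤L c≤L ≤-refl) ]′
      cocliqueOrCliques
    where
    N M n : ℕ
    N = L ^ gridExponent
    M = L ^ suc eRow
    n = L ^ suc eCol

    instance
      M≢0 : NonZero M
      M≢0 = m^n≢0 L (suc eRow)
      n≢0 : NonZero n
      n≢0 = m^n≢0 L (suc eCol)
      Mʳn≢0 : NonZero (M ^ r * n)
      Mʳn≢0 = m*n≢0 (M ^ r) n {{m^n≢0 M r}}

    N≡M*Mʳn : N ≡ M * (M ^ r * n)
    N≡M*Mʳn = begin
      L ^ (suc eRow * suc r + suc eCol)   ≡⟨ ^-distribˡ-+-* L (suc eRow * suc r) (suc eCol) ⟩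
      L ^ (suc eRow * suc r) * n          ≡⟨ cong (_* n) (sym (^-*-assoc L (suc eRow) (suc r))) ⟩
      M * M ^ r * n                       ≡⟨ *-assoc M (M ^ r) n ⟩
      M * (M ^ r * n)                     ∎
      where open ≡-Reasoning

    Mʳn≤N : M ^ r * n ≤ N
    Mʳn≤N = subst (M ^ r * n ≤_) (sym N≡M*Mʳn) (m≤n*m (M ^ r * n) M)

    M≤N : M ≤ N
    M≤N = subst (M ≤_) (sym N≡M*Mʳn) (m≤m*n M (M ^ r * n))

    rows : Fin M → Fin N
    rows = proj₁ (initialSegment M≤N)

    rows-inj : Injective _≡_ _≡_ rows
    rows-inj = proj₂ (initialSegment M≤N)

    cocliqueOrCliques : HasCoclique G k ⊎ (∀ x → ColumnClique G rows x)
    cocliqueOrCliques =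
      sequence (SumLeft.applicative (HasCoclique G k) 0ℓ)
               (columnCoclique-or-clique gG k≤L r≤L ≤-refl rows rows-inj)

theorem1p5 : MultiColorEH → ∀ {c r : ℕ} (H : Grid c r) → IsGridSubgraph H → NoTwoHorizontalSameColumns H → InPGR H
theorem1p5 eh {c} {r} H gH noTwo = suc (c + r) * gridExponent , bound
  where
  open GridRamsey eh H gH noTwo

  bound : ∀ k → 2 ≤ k → GrAtMost H k (k ^ (suc (c + r) * gridExponent))
  bound k 1<k =
    L ^ gridExponent , ≤-reflexive (^-*-assoc k (suc (c + r)) gridExponent) , gridRamsey k≤L c≤L r≤L
    where
    L : ℕ
    L = k ^ suc (c + r)

    instance
      k≢0 : NonZero k
      k≢0 = >-nonZero (<-trans z<s 1<k)
      L≢0 : NonZero L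
      L≢0 = m^n≢0 k (suc (c + r))

    c+r<L : c + r < L
    c+r<L = <-trans (n<1+n (c + r)) (n<m^n (suc (c + r)) 1<k)

    k≤L : k ≤ L
    k≤L = m≤m^[1+n] k (c + r)

    c≤L : c ≤ L
    c≤L = ≤-trans (m≤m+n c r) (<⇒≤ c+r<L)

    r≤L : r ≤ L
    r≤L = ≤-trans (m≤n+m r c) (<⇒≤ c+r<L)
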